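{- Let $D>1$ be a squarefree integer and $F=\mathbb{Q}(\sqrt D)$. (1) If $\alpha\in\mathcal{O}_F\setminus\mathbb{Z}$, then $\max\{|\alpha|,|\alpha'|\}\ge\frac{\sqrt{\Delta_D}}{2}$. (2) Let $L$ be a classical totally positive definite $\mathcal{O}_F$-lattice and $v,w\in L$ with $Q(v)Q(w)\prec\frac{\Delta_D}{4}$. Then $\mathcal{B}(v,w)\in\mathbb{Z}$.
   Context: $\alpha'$ denotes the Galois conjugate of $\alpha\in F$. $\Delta_D$ is the discriminant of $F$ ($D$ if $D\equiv1\pmod4$, $4D$ otherwise). For $\alpha,\beta\in F$, $\alpha\prec\beta$ means $\beta-\alpha$ is totally positive (i.e. $\beta-\alpha>0$ and $\beta'-\alpha'>0$). For a quadratic space $(V,Q)$ over $F$, $\mathcal{B}(v,w)=\frac12(Q(v+w)-Q(v)-Q(w))$. A quadratic $\mathcal{O}_F$-lattice is a finitely generated $\mathcal{O}_F$-submodule $L\subseteq V$ with $Q(L)\subseteq\mathcal{O}_F$; classical means $\mathcal{B}(L,L)\subseteq\mathcal{O}_F$; totally positive definite means $Q(v)$ is totally positive for all nonzero $v\in L$. -}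

module Defs where

open import Data.Nat as ℕ using (ℕ; zero; suc; _%_)
open import Data.Nat.Divisibility using (_∣_)
open import Data.Integer as ℤ using (ℤ; +_)
open import Data.Rational as ℚ using (ℚ; 0ℚ; 1ℚ; ½; _/_)
open import Data.Rational.Properties as ℚP using ()
open import Data.Fin using (Fin; zero; suc)
open import Data.Product using (Σ; ∃; _×_; _,_)
open import Data.Sum using (_⊎_)
open import Data.Bool using (if_then_else_)
open import Relation.Nullary using (¬_; Dec)
open import Relation.Nullary.Decidable using (_×-dec_; _⊎-dec_; isYes)
open import Relation.Binary.PropositionalEquality using (_≡_)

Squarefree : ℕ → Set
Squarefree D = ∀ (k : ℕ) → k ℕ.* k ∣ D → k ≡ 1

ιℤ : ℤ → ℚ
ιℤ z = z / 1

-- The real quadratic field F = ℚ(√D); an element a + b√D is the pair (a , b).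
-- The real-embedding order is the one induced by √D > 0.
module QF (D : ℕ) where

  record F : Set where
    constructor _+√D·_
    field
      re : ℚ
      ir : ℚ
  infix 4 _+√D·_
  open F public

  Dℚ : ℚ
  Dℚ = + D / 1

  fromℚ : ℚ → F
  fromℚ q = q +√D· 0ℚ

  0F 1F : F
  0F = fromℚ 0ℚ
  1F = fromℚ 1ℚ

  _+F_ _-F_ _*F_ : F → F → F
  (a +√D· b) +F (c +√D· d) = (a ℚ.+ c) +√D· (b ℚ.+ d)
  (a +√D· b) -F (c +√D· d) = (a ℚ.- c) +√D· (b ℚ.- d)
  (a +√D· b) *F (c +√D· d) = (a ℚ.* c ℚ.+ b ℚ.* d ℚ.* Dℚ) +√D· (a ℚ.* d ℚ.+ b ℚ.* c)
  infixl 6 _+F_ _-F_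
  infixl 7 _*F_

  -F_ : F → F
  -F (a +√D· b) = ℚ.- a +√D· ℚ.- b

  conj : F → F
  conj (a +√D· b) = a +√D· ℚ.- b

  -- a + b√D > 0 as a real number (√D > 0)
  Pos : F → Set
  Pos (a +√D· b) =
      (0ℚ ℚ.< a × Dℚ ℚ.* b ℚ.* b ℚ.< a ℚ.* a)
    ⊎ (0ℚ ℚ.< b × a ℚ.* a ℚ.< Dℚ ℚ.* b ℚ.* b)
    ⊎ (0ℚ ℚ.< a × 0ℚ ℚ.< b)

  Pos? : (α : F) → Dec (Pos α)
  Pos? (a +√D· b) =
      ((0ℚ ℚP.<? a) ×-dec (Dℚ ℚ.* b ℚ.* b ℚP.<? a ℚ.* a))
    ⊎-dec ((0ℚ ℚP.<? b) ×-dec (a ℚ.* a ℚP.<? Dℚ ℚ.* b ℚ.* b))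
    ⊎-dec ((0ℚ ℚP.<? a) ×-dec (0ℚ ℚP.<? b))

  _<F_ _≤F_ : F → F → Set
  infix 4 _<F_ _≤F_ _≺_
  α <F β = Pos (β -F α)
  α ≤F β = α <F β ⊎ α ≡ β

  absF : F → F
  absF α = if isYes (Pos? α) then α else -F α

  maxF : F → F → F
  maxF α β = if isYes (Pos? (β -F α)) then β else α

  TotPos : F → Set
  TotPos α = Pos α × Pos (conj α)

  _≺_ : F → F → Set
  α ≺ β = TotPos (β -F α)

  D≡1mod4 : Set
  D≡1mod4 = D % 4 ≡ 1

  D≡1mod4? : Dec D≡1mod4
  D≡1mod4? = D % 4 ℕ.≟ 1

  Δ : ℕ
  Δ = if isYes D≡1mod4? then D else 4 ℕ.* D

  -- ω with O_F = ℤ[ω]: ω = (1+√D)/2 if D ≡ 1 (mod 4), ω = √D otherwise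
  ω : F
  ω = if isYes D≡1mod4? then (½ +√D· ½) else (0ℚ +√D· 1ℚ)

  -- √Δ_D as an element of F (√D or 2√D), it is positive and squares to Δ_D
  √Δ : F
  √Δ = if isYes D≡1mod4? then (0ℚ +√D· 1ℚ) else (0ℚ +√D· (+ 2 / 1))

  InO : F → Set
  InO α = Σ ℤ λ m → Σ ℤ λ n → α ≡ fromℚ (ιℤ m) +F fromℚ (ιℤ n) *F ω

  InZ : F → Set
  InZ α = Σ ℤ λ m → α ≡ fromℚ (ιℤ m)

  ΣF : (n : ℕ) → (Fin n → F) → F
  ΣF zero f = 0F
  ΣF (suc n) f = f zero +F ΣF n (λ i → f (suc i))

  Vec : ℕ → Set
  Vec n = Fin n → F

  Qf : {n : ℕ} → (Fin n → Fin n → F) → Vec n → F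
  Qf {n} A x = ΣF n λ i → ΣF n λ j → A i j *F x i *F x j

  Bf : {n : ℕ} → (Fin n → Fin n → F) → Vec n → Vec n → F
  Bf A v w = fromℚ ½ *F (Qf A (λ i → v i +F w i) -F Qf A v -F Qf A w)

  -- the finitely generated O_F-submodule L of F^n spanned by g_1..g_m
  InL : {n m : ℕ} → (Fin m → Vec n) → Vec n → Set
  InL {n} {m} g x =
    Σ (Fin m → F) λ c → (∀ k → InO (c k)) × (∀ i → x i ≡ ΣF m (λ k → c k *F g k i))

  IsZeroVec : {n : ℕ} → Vec n → Set
  IsZeroVec x = ∀ i → x i ≡ 0F

  IsQuadLattice : {n m : ℕ} → (Fin n → Fin n → F) → (Fin m → Vec n) → Set
  IsQuadLattice A g = ∀ x → InL g x → InO (Qf A x)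

  IsClassical : {n m : ℕ} → (Fin n → Fin n → F) → (Fin m → Vec n) → Set
  IsClassical A g = ∀ x y → InL g x → InL g y → InO (Bf A x y)

  IsTotPosDef : {n m : ℕ} → (Fin n → Fin n → F) → (Fin m → Vec n) → Set
  IsTotPosDef A g = ∀ x → InL g x → ¬ IsZeroVec x → TotPos (Qf A x)

{-# OPTIONS --safe #-}
-- Write elements of F as a + b√D. An element m + nω of O_F has irrational part
-- b = n · ir ω, and for both shapes of ω one has ir ω · √D = √Δ / 2 and
-- D (ir ω)² = Δ / 4; so α ∈ O_F ∖ ℤ has |b| ≥ ir ω.
-- (1) As √D is irrational, α and α′ are nonzero reals, absF picks the positive
-- one of ±α (and of ±α′), and max(|α|, |α′|) = |a| + |b|√D ≥ ir ω · √D = √Δ / 2.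
-- (2) Let B = B(v, w) = a + b√D ∈ O_F. For w ≠ 0 the vector Q(w) v − B w lies in L
-- and Q(Q(w) v − B w) = Q(w) (Q(v) Q(w) − B²) is 0 or totally positive; as Q(w) ≻ 0,
-- the rational part a² + D b² of B² is at most that of Q(v) Q(w), which is below
-- Δ / 4 = D (ir ω)². Hence b = 0, i.e. B ∈ ℤ (and B = 0 when w = 0).
module Submission where

open import Level using (0ℓ)
open import Data.Nat as ℕ using (ℕ; zero; suc)
import Data.Nat.Properties as ℕP
open import Data.Nat.Divisibility using (divides; ∣-refl)
open import Data.Nat.DivMod using (m/n*n≡m; m≡m%n+[m/n]*n) renaming (_/_ to _div_)
open import Data.Nat.GCD using (gcd; gcd[m,n]≢0; gcd[m,n]∣m; gcd[m,n]∣n)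
import Data.Nat.Coprimality as Coprimality
import Data.Nat.Solver as ℕ-Solver
open import Data.Integer as ℤ using (ℤ; +_)
import Data.Integer.Properties as ℤP
import Data.Integer.Solver as ℤ-Solver
open import Data.Rational as ℚ using (ℚ; mkℚ; 0ℚ; 1ℚ; ½; _/_; ↥_; ↧_; ∣_∣)
import Data.Rational.Properties as ℚP
import Data.Rational.Solver as ℚ-Solver
import Data.Rational.Unnormalised as ℚᵘ
import Data.Rational.Unnormalised.Properties as ℚᵘP
open import Data.Fin using (Fin; zero; suc)
import Data.Fin.Properties as FinP
open import Data.Empty using (⊥-elim)
open import Data.Product as Product using (Σ; _×_; _,_)
open import Data.Sum as Sum using (_⊎_; inj₁; inj₂; [_,_]′)
open import Data.Maybe as Maybe using ()
open import Function using (_$_; id)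
open import Data.Bool using (if_then_else_)
open import Algebra.Bundles using (CommutativeRing)
open import Algebra.Structures using (IsCommutativeRing)
import Algebra.Solver.Ring as RingSolver
open import Algebra.Solver.Ring.AlmostCommutativeRing
  using (fromCommutativeRing; _-Raw-AlmostCommutative⟶_)
open import Relation.Nullary using (¬_; Dec; yes; no)
open import Relation.Nullary.Decidable using (dec⇒maybe; isYes)
open import Relation.Binary.Definitions using (Tri; tri<; tri≈; tri>)
open import Relation.Binary.PropositionalEquality
open import Defs

-- √D is irrational

module _ {D : ℕ} (1<D : 1 ℕ.< D) (sqf : Squarefree D) where
  open import Data.Nat using (_*_)

  sq≡D*sq⇒≡0 : ∀ a b → a * a ≡ D * (b * b) → b ≡ 0
  sq≡D*sq⇒≡0 a zero        _  = refl
  sq≡D*sq⇒≡0 a b@(suc _) eq = ⊥-elim (ℕP.<-irrefl (sym D≡1) 1<D)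
    where
    g = gcd a b
    instance
      g≢0 : ℕ.NonZero g
      g≢0 = ℕ.≢-nonZero (gcd[m,n]≢0 a b (inj₂ λ ()))
    a′ = a div g
    b′ = b div g
    coprime : Coprimality.Coprime a′ b′
    coprime = Coprimality.coprime-/gcd a b
    eq′ : a′ * a′ ≡ D * (b′ * b′)
    eq′ = ℕP.*-cancelʳ-≡ (a′ * a′) (D * (b′ * b′)) (g * g) {{ℕP.m*n≢0 g g}} $ begin
      a′ * a′ * (g * g)          ≡⟨ solve 2 (λ x y → x :* x :* (y :* y) := (x :* y) :* (x :* y)) refl a′ g ⟩
      (a′ * g) * (a′ * g)        ≡⟨ cong (λ x → x * x) (m/n*n≡m (gcd[m,n]∣m a b)) ⟩
      a * a                      ≡⟨ eq ⟩
      D * (b * b)                ≡⟨ cong (λ x → D * (x * x)) (m/n*n≡m (gcd[m,n]∣n a b)) ⟨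
      D * ((b′ * g) * (b′ * g))  ≡⟨ solve 3 (λ d x y → d :* ((x :* y) :* (x :* y)) := d :* (x :* x) :* (y :* y))
                                          refl D b′ g ⟩
      D * (b′ * b′) * (g * g)    ∎
      where
      open ≡-Reasoning
      open ℕ-Solver.+-*-Solver
    b′≡1 : b′ ≡ 1
    b′≡1 = coprime (Coprimality.coprime-divisor (Coprimality.sym coprime)
                      (divides (D * b′) (trans eq′ (sym (ℕP.*-assoc D b′ b′)))) , ∣-refl)
    a′*a′≡D : a′ * a′ ≡ D
    a′*a′≡D = trans eq′ (trans (cong (λ x → D * (x * x)) b′≡1) (ℕP.*-identityʳ D))
    D≡1 : D ≡ 1
    D≡1 = trans (sym a′*a′≡D) (cong (λ x → x * x) a′≡1)
      where
      a′≡1 : a′ ≡ 1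
      a′≡1 = sqf a′ (divides 1 (sym (trans (ℕP.*-identityˡ (a′ * a′)) a′*a′≡D)))

  ℤ-sq≡D*sq⇒≡0 : ∀ x y → x ℤ.* x ≡ + D ℤ.* (y ℤ.* y) → y ≡ + 0
  ℤ-sq≡D*sq⇒≡0 x y eq = ℤP.∣i∣≡0⇒i≡0 $ sq≡D*sq⇒≡0 ℤ.∣ x ∣ ℤ.∣ y ∣ $ begin
    ℤ.∣ x ∣ * ℤ.∣ x ∣        ≡⟨ ℤP.abs-* x x ⟨
    ℤ.∣ x ℤ.* x ∣            ≡⟨ cong ℤ.∣_∣ eq ⟩
    ℤ.∣ + D ℤ.* (y ℤ.* y) ∣  ≡⟨ ℤP.abs-* (+ D) (y ℤ.* y) ⟩
    D * ℤ.∣ y ℤ.* y ∣        ≡⟨ cong (D *_) (ℤP.abs-* y y) ⟩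
    D * (ℤ.∣ y ∣ * ℤ.∣ y ∣)  ∎
    where open ≡-Reasoning

  ℚ-sq≡D*sq⇒≡0 : ∀ a b → a ℚ.* a ≡ ιℤ (+ D) ℚ.* b ℚ.* b → b ≡ 0ℚ
  ℚ-sq≡D*sq⇒≡0 a@(mkℚ _ _ _) b@(mkℚ _ _ _) eq = ℚP.↥p≡0⇒p≡0 b $
    ℤP.*-cancelʳ-≡ (↥ b) (+ 0) (↧ a) (ℤ-sq≡D*sq⇒≡0 (↥ a ℤ.* ↧ b) (↥ b ℤ.* ↧ a) cleared)
    where
    open ℚᵘ using (_≃_; *≡*)
    eqᵘ : ℚ.toℚᵘ a ℚᵘ.* ℚ.toℚᵘ a ≃ ℚᵘ.mkℚᵘ (+ D) 0 ℚᵘ.* ℚ.toℚᵘ b ℚᵘ.* ℚ.toℚᵘ b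
    eqᵘ = begin
      ℚ.toℚᵘ a ℚᵘ.* ℚ.toℚᵘ a                         ≈⟨ ℚP.toℚᵘ-homo-* a a ⟨
      ℚ.toℚᵘ (a ℚ.* a)                               ≈⟨ ℚP.toℚᵘ-cong eq ⟩
      ℚ.toℚᵘ (ιℤ (+ D) ℚ.* b ℚ.* b)                   ≈⟨ ℚP.toℚᵘ-homo-* (ιℤ (+ D) ℚ.* b) b ⟩
      ℚ.toℚᵘ (ιℤ (+ D) ℚ.* b) ℚᵘ.* ℚ.toℚᵘ b           ≈⟨ ℚᵘP.*-congʳ (ℚP.toℚᵘ-homo-* (ιℤ (+ D)) b) ⟩
      ℚ.toℚᵘ (ιℤ (+ D)) ℚᵘ.* ℚ.toℚᵘ b ℚᵘ.* ℚ.toℚᵘ b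
        ≈⟨ ℚᵘP.*-congʳ (ℚᵘP.*-congʳ (ℚP.toℚᵘ-fromℚᵘ (ℚᵘ.mkℚᵘ (+ D) 0))) ⟩
      ℚᵘ.mkℚᵘ (+ D) 0 ℚᵘ.* ℚ.toℚᵘ b ℚᵘ.* ℚ.toℚᵘ b     ∎
      where open ℚᵘP.≃-Reasoning
    cleared : (↥ a ℤ.* ↧ b) ℤ.* (↥ a ℤ.* ↧ b) ≡ + D ℤ.* ((↥ b ℤ.* ↧ a) ℤ.* (↥ b ℤ.* ↧ a))
    cleared with eqᵘ
    ... | *≡* e = begin
      (↥ a ℤ.* ↧ b) ℤ.* (↥ a ℤ.* ↧ b)
        ≡⟨ solve 2 (λ x y → (x :* y) :* (x :* y) := x :* x :* (con (+ 1) :* y :* y)) refl (↥ a) (↧ b) ⟩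
      ↥ a ℤ.* ↥ a ℤ.* (+ 1 ℤ.* ↧ b ℤ.* ↧ b)
        ≡⟨ e ⟩
      + D ℤ.* ↥ b ℤ.* ↥ b ℤ.* (↧ a ℤ.* ↧ a)
        ≡⟨ solve 3 (λ d x y → d :* x :* x :* (y :* y) := d :* ((x :* y) :* (x :* y))) refl (+ D) (↥ b) (↧ a) ⟩
      + D ℤ.* ((↥ b ℤ.* ↧ a) ℤ.* (↥ b ℤ.* ↧ a))
        ∎
      where
      open ≡-Reasoning
      open ℤ-Solver.+-*-Solver

module _ where
  open import Data.Rational using (_+_; _*_; -_; _-_; _<_; _≤_)

  private
    ιℤ≡mkℚ : ∀ z → ιℤ z ≡ mkℚ z 0 (Coprimality.sym (Coprimality.1-coprimeTo _))
    ιℤ≡mkℚ z = ℚP.↥p/↧p≡p (mkℚ z 0 (Coprimality.sym (Coprimality.1-coprimeTo _)))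

  ιℤ-+ : ∀ x y → ιℤ (x ℤ.+ y) ≡ ιℤ x + ιℤ y
  ιℤ-+ x y rewrite ιℤ≡mkℚ x | ιℤ≡mkℚ y =
    ℚP./-cong (cong₂ ℤ._+_ (sym (ℤP.*-identityʳ x)) (sym (ℤP.*-identityʳ y))) refl

  ιℤ-* : ∀ x y → ιℤ (x ℤ.* y) ≡ ιℤ x * ιℤ y
  ιℤ-* x y rewrite ιℤ≡mkℚ x | ιℤ≡mkℚ y = refl

  ιℤ-neg : ∀ x → ιℤ (ℤ.- x) ≡ - ιℤ x
  ιℤ-neg x rewrite ιℤ≡mkℚ (ℤ.- x) | ιℤ≡mkℚ x with x
  ... | + zero    = refl
  ... | ℤ.+[1+ _ ] = refl
  ... | ℤ.-[1+ _ ] = refl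

  1≤∣ιℤ∣ : ∀ {n} → n ≢ + 0 → 1ℚ ≤ ∣ ιℤ n ∣
  1≤∣ιℤ∣ {n} n≢0 rewrite ιℤ≡mkℚ n with n
  ... | + zero     = ⊥-elim (n≢0 refl)
  ... | ℤ.+[1+ _ ] = ℚ.*≤* (ℤ.+≤+ (ℕ.s≤s ℕ.z≤n))
  ... | ℤ.-[1+ _ ] = ℚ.*≤* (ℤ.+≤+ (ℕ.s≤s ℕ.z≤n))

  <⇒≱ : ∀ {x y} → x < y → ¬ y ≤ x
  <⇒≱ x<y y≤x = ℚP.<-irrefl refl (ℚP.<-≤-trans x<y y≤x)

  *-pos : ∀ {x y} → 0ℚ < x → 0ℚ < y → 0ℚ < x * y
  *-pos {x} {y} 0<x 0<y =
    ℚP.positive⁻¹ (x * y) {{ℚP.pos*pos⇒pos x {{ℚ.positive 0<x}} y {{ℚ.positive 0<y}}}}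

  *-nonNeg : ∀ {x y} → 0ℚ ≤ x → 0ℚ ≤ y → 0ℚ ≤ x * y
  *-nonNeg {x} {y} 0≤x 0≤y =
    ℚP.nonNegative⁻¹ (x * y) {{ℚP.nonNeg*nonNeg⇒nonNeg x {{ℚ.nonNegative 0≤x}} y {{ℚ.nonNegative 0≤y}}}}

  -x*-x≡x*x : ∀ x → - x * - x ≡ x * x
  -x*-x≡x*x = solve 1 (λ x → :- x :* :- x := x :* x) refl where open ℚ-Solver.+-*-Solver

  0≤x*x : ∀ x → 0ℚ ≤ x * x
  0≤x*x x with ℚP.<-cmp 0ℚ x
  ... | tri< 0<x _ _  = ℚP.<⇒≤ (*-pos 0<x 0<x)
  ... | tri≈ _ refl _ = ℚP.≤-refl
  ... | tri> _ _ x<0  =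
    subst (0ℚ ≤_) (-x*-x≡x*x x) (ℚP.<⇒≤ (*-pos (ℚP.neg-antimono-< x<0) (ℚP.neg-antimono-< x<0)))

  neg-involutive : ∀ x → - - x ≡ x
  neg-involutive = solve 1 (λ x → :- :- x := x) refl where open ℚ-Solver.+-*-Solver

  0<x⇒0≮-x : ∀ {x} → 0ℚ < x → ¬ 0ℚ < - x
  0<x⇒0≮-x {x} 0<x 0<-x = ℚP.<-asym 0<x (subst (_< 0ℚ) (neg-involutive x) (ℚP.neg-antimono-< 0<-x))

  *-mono-≤-nonNeg : ∀ {a b c d} → 0ℚ ≤ a → a ≤ b → 0ℚ ≤ c → c ≤ d → a * c ≤ b * d
  *-mono-≤-nonNeg {a} {b} {c} {d} 0≤a a≤b 0≤c c≤d = ℚP.≤-trans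
    (ℚP.*-monoʳ-≤-nonNeg c {{ℚ.nonNegative 0≤c}} a≤b)
    (ℚP.*-monoˡ-≤-nonNeg b {{ℚ.nonNegative (ℚP.≤-trans 0≤a a≤b)}} c≤d)

  *-mono-<-nonNeg : ∀ {a b c d} → 0ℚ ≤ a → a < b → 0ℚ ≤ c → c < d → a * c < b * d
  *-mono-<-nonNeg {a} {b} {c} {d} 0≤a a<b 0≤c c<d = ℚP.≤-<-trans
    (ℚP.*-monoʳ-≤-nonNeg c {{ℚ.nonNegative 0≤c}} (ℚP.<⇒≤ a<b))
    (ℚP.*-monoʳ-<-pos b {{ℚ.positive (ℚP.≤-<-trans 0≤a a<b)}} c<d)

  x*x<y*y⇒x<y : ∀ {x y} → 0ℚ ≤ y → x * x < y * y → x < y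
  x*x<y*y⇒x<y {x} {y} 0≤y x²<y² = ℚP.≰⇒> λ y≤x → <⇒≱ x²<y² (*-mono-≤-nonNeg 0≤y y≤x 0≤y y≤x)

  0<x+x⇒0<x : ∀ {x} → 0ℚ < x + x → 0ℚ < x
  0<x+x⇒0<x {x} 0<x+x = ℚP.≰⇒> λ x≤0 → <⇒≱ 0<x+x (ℚP.+-mono-≤ {x} {0ℚ} {x} {0ℚ} x≤0 x≤0)

  0<-x⇒∣x∣≡-x : ∀ {x} → 0ℚ < - x → ∣ x ∣ ≡ - x
  0<-x⇒∣x∣≡-x {x} 0<-x = trans (sym (ℚP.∣-p∣≡∣p∣ x)) (ℚP.0≤p⇒∣p∣≡p (ℚP.<⇒≤ 0<-x))

  0≮-x⇒∣x∣≡x : ∀ {x} → ¬ 0ℚ < - x → ∣ x ∣ ≡ x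
  0≮-x⇒∣x∣≡x 0≮-x = ℚP.0≤p⇒∣p∣≡p (ℚP.≮⇒≥ λ x<0 → 0≮-x (ℚP.neg-antimono-< x<0))

  y-x+x≡y : ∀ x y → y - x + x ≡ y
  y-x+x≡y = solve 2 (λ x y → y :- x :+ x := y) refl where open ℚ-Solver.+-*-Solver

  ≤⇒<⊎≡ : ∀ {x y} → x ≤ y → x < y ⊎ x ≡ y
  ≤⇒<⊎≡ {x} {y} x≤y with ℚP.<-cmp x y
  ... | tri< x<y _ _ = inj₁ x<y
  ... | tri≈ _ x≡y _ = inj₂ x≡y
  ... | tri> _ _ y<x = ⊥-elim (<⇒≱ y<x x≤y)

  0<y-x⇒x<y : ∀ {x y} → 0ℚ < y - x → x < y
  0<y-x⇒x<y {x} {y} 0<y-x = subst₂ _<_ (ℚP.+-identityˡ x) (y-x+x≡y x y) (ℚP.+-monoˡ-< x 0<y-x)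

  0≤y-x⇒x≤y : ∀ {x y} → 0ℚ ≤ y - x → x ≤ y
  0≤y-x⇒x≤y {x} {y} 0≤y-x = subst₂ _≤_ (ℚP.+-identityˡ x) (y-x+x≡y x y) (ℚP.+-monoˡ-≤ x 0≤y-x)

  x<y⇒0<y-x : ∀ {x y} → x < y → 0ℚ < y - x
  x<y⇒0<y-x {x} {y} x<y = subst (_< y - x) (ℚP.+-inverseʳ x) (ℚP.+-monoˡ-< (- x) x<y)

  y-x≡0⇒x≡y : ∀ {x y} → y - x ≡ 0ℚ → x ≡ y
  y-x≡0⇒x≡y {x} {y} y-x≡0 =
    trans (sym (ℚP.+-identityˡ x)) (trans (cong (_+ x) (sym y-x≡0)) (y-x+x≡y x y))

  x≤y⇒0≤y-x : ∀ {x y} → x ≤ y → 0ℚ ≤ y - x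
  x≤y⇒0≤y-x {x} {y} x≤y = subst (_≤ y - x) (ℚP.+-inverseʳ x) (ℚP.+-monoˡ-≤ (- x) x≤y)

-- F = ℚ(√D) as a commutative ring

module _ (D : ℕ) where
  open QF D
  open import Data.Rational using (_+_; _*_; -_; _-_; _<_; _≤_)

  F-ext : ∀ {a b c d} → a ≡ c → b ≡ d → (a +√D· b) ≡ (c +√D· d)
  F-ext = cong₂ _+√D·_

  fromℚ-+ : ∀ a b → fromℚ (a + b) ≡ fromℚ a +F fromℚ b
  fromℚ-+ a b = F-ext refl refl

  fromℚ-* : ∀ a b → fromℚ (a * b) ≡ fromℚ a *F fromℚ b
  fromℚ-* a b = F-ext (solve 3 (λ a b r → a :* b := a :* b :+ con 0ℚ :* con 0ℚ :* r) refl a b Dℚ)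
                      (solve 2 (λ a b → con 0ℚ := a :* con 0ℚ :+ con 0ℚ :* b) refl a b)
    where open ℚ-Solver.+-*-Solver

  F-isCommutativeRing : IsCommutativeRing _≡_ _+F_ _*F_ (λ x → -F x) 0F 1F
  F-isCommutativeRing = record
    { isRing = record
      { +-isAbelianGroup = record
        { isGroup = record
          { isMonoid = record
            { isSemigroup = record
              { isMagma = record { isEquivalence = isEquivalence ; ∙-cong = cong₂ _+F_ }
              ; assoc = +F-assoc }
            ; identity = +F-identityˡ , λ x → trans (+F-comm x 0F) (+F-identityˡ x) }
          ; inverse = -F-inverseˡ , λ x → trans (+F-comm x (-F x)) (-F-inverseˡ x)
          ; ⁻¹-cong = cong (λ x → -F x) }
        ; comm = +F-comm }
      ; *-cong = cong₂ _*F_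
      ; *-assoc = *F-assoc
      ; *-identity = *F-identityˡ , λ x → trans (*F-comm x 1F) (*F-identityˡ x)
      ; distrib = *F-distribˡ-+F , λ x y z → trans (*F-comm (y +F z) x)
                    (trans (*F-distribˡ-+F x y z) (cong₂ _+F_ (*F-comm x y) (*F-comm x z))) }
    ; *-comm = *F-comm }
    where
    open ℚ-Solver.+-*-Solver

    +F-assoc : ∀ x y z → (x +F y) +F z ≡ x +F (y +F z)
    +F-assoc (a +√D· b) (c +√D· d) (e +√D· f) = F-ext (ℚP.+-assoc a c e) (ℚP.+-assoc b d f)

    +F-comm : ∀ x y → x +F y ≡ y +F x
    +F-comm (a +√D· b) (c +√D· d) = F-ext (ℚP.+-comm a c) (ℚP.+-comm b d)

    +F-identityˡ : ∀ x → 0F +F x ≡ x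
    +F-identityˡ (a +√D· b) = F-ext (ℚP.+-identityˡ a) (ℚP.+-identityˡ b)

    -F-inverseˡ : ∀ x → (-F x) +F x ≡ 0F
    -F-inverseˡ (a +√D· b) = F-ext (ℚP.+-inverseˡ a) (ℚP.+-inverseˡ b)

    *F-assoc : ∀ x y z → (x *F y) *F z ≡ x *F (y *F z)
    *F-assoc (a +√D· b) (c +√D· d) (e +√D· f) = F-ext
      (solve 7 (λ a b c d e f r → (a :* c :+ b :* d :* r) :* e :+ (a :* d :+ b :* c) :* f :* r
                               := a :* (c :* e :+ d :* f :* r) :+ b :* (c :* f :+ d :* e) :* r) refl a b c d e f Dℚ)
      (solve 7 (λ a b c d e f r → (a :* c :+ b :* d :* r) :* f :+ (a :* d :+ b :* c) :* e
                               := a :* (c :* f :+ d :* e) :+ b :* (c :* e :+ d :* f :* r)) refl a b c d e f Dℚ)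

    *F-comm : ∀ x y → x *F y ≡ y *F x
    *F-comm (a +√D· b) (c +√D· d) = F-ext
      (solve 5 (λ a b c d r → a :* c :+ b :* d :* r := c :* a :+ d :* b :* r) refl a b c d Dℚ)
      (solve 4 (λ a b c d → a :* d :+ b :* c := c :* b :+ d :* a) refl a b c d)

    *F-identityˡ : ∀ x → 1F *F x ≡ x
    *F-identityˡ (a +√D· b) = F-ext
      (solve 3 (λ a b r → con 1ℚ :* a :+ con 0ℚ :* b :* r := a) refl a b Dℚ)
      (solve 2 (λ a b → con 1ℚ :* b :+ con 0ℚ :* a := b) refl a b)

    *F-distribˡ-+F : ∀ x y z → x *F (y +F z) ≡ x *F y +F x *F z
    *F-distribˡ-+F (a +√D· b) (c +√D· d) (e +√D· f) = F-ext
      (solve 7 (λ a b c d e f r → a :* (c :+ e) :+ b :* (d :+ f) :* r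
                               := (a :* c :+ b :* d :* r) :+ (a :* e :+ b :* f :* r)) refl a b c d e f Dℚ)
      (solve 6 (λ a b c d e f → a :* (d :+ f) :+ b :* (c :+ e)
                             := (a :* d :+ b :* c) :+ (a :* f :+ b :* e)) refl a b c d e f)

  F-commutativeRing : CommutativeRing 0ℓ 0ℓ
  F-commutativeRing = record { isCommutativeRing = F-isCommutativeRing }

  fromℚ-homomorphism : ℚ.+-*-rawRing -Raw-AlmostCommutative⟶ fromCommutativeRing F-commutativeRing
  fromℚ-homomorphism = record
    { ⟦_⟧    = fromℚ
    ; +-homo = fromℚ-+
    ; *-homo = fromℚ-*
    ; -‿homo = λ _ → refl
    ; 0-homo = refl
    ; 1-homo = refl
    }

  fromℚ-≟ : (a b : ℚ) → Maybe.Maybe (fromℚ a ≡ fromℚ b)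
  fromℚ-≟ a b = Maybe.map (cong fromℚ) (dec⇒maybe (a ℚP.≟ b))

  module F-Solver =
    RingSolver ℚ.+-*-rawRing (fromCommutativeRing F-commutativeRing) fromℚ-homomorphism fromℚ-≟

  _≟F_ : (x y : F) → Dec (x ≡ y)
  (a +√D· b) ≟F (c +√D· d) with a ℚP.≟ c | b ℚP.≟ d
  ... | yes refl | yes refl = yes refl
  ... | no a≢c   | _        = no λ eq → a≢c (cong re eq)
  ... | yes _    | no b≢d   = no λ eq → b≢d (cong ir eq)

  IsZeroVec? : ∀ {n} (x : Vec n) → Dec (IsZeroVec x)
  IsZeroVec? x = FinP.all? λ i → x i ≟F 0F

  ΣF-cong : ∀ n {f g : Fin n → F} → (∀ i → f i ≡ g i) → ΣF n f ≡ ΣF n g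
  ΣF-cong zero    _   = refl
  ΣF-cong (suc n) f≗g = cong₂ _+F_ (f≗g zero) (ΣF-cong n λ i → f≗g (suc i))

  ΣF-linear : ∀ n s t (f g : Fin n → F) →
              ΣF n (λ i → s *F f i +F t *F g i) ≡ s *F ΣF n f +F t *F ΣF n g
  ΣF-linear zero    s t f g = solve 2 (λ s t → con 0ℚ := s :* con 0ℚ :+ t :* con 0ℚ) refl s t
    where open F-Solver
  ΣF-linear (suc n) s t f g = begin
    (s *F f zero +F t *F g zero) +F ΣF n (λ i → s *F f (suc i) +F t *F g (suc i))
      ≡⟨ cong ((s *F f zero +F t *F g zero) +F_) (ΣF-linear n s t (λ i → f (suc i)) (λ i → g (suc i))) ⟩
    (s *F f zero +F t *F g zero) +F (s *F Σf +F t *F Σg)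
      ≡⟨ solve 6 (λ s t x y X Y → (s :* x :+ t :* y) :+ (s :* X :+ t :* Y) := s :* (x :+ X) :+ t :* (y :+ Y))
                 refl s t (f zero) (g zero) Σf Σg ⟩
    s *F ΣF (suc n) f +F t *F ΣF (suc n) g ∎
    where
    open ≡-Reasoning
    open F-Solver
    Σf = ΣF n λ i → f (suc i)
    Σg = ΣF n λ i → g (suc i)

  bilinear : ∀ {n} → (Fin n → Fin n → F) → Vec n → Vec n → F
  bilinear {n} A x y = ΣF n λ i → ΣF n λ j → A i j *F x i *F y j

  module _ {n : ℕ} (A : Fin n → Fin n → F) where
    open F-Solver

    bilinear-cong : ∀ {x x′ y y′ : Vec n} → (∀ i → x i ≡ x′ i) → (∀ i → y i ≡ y′ i) →
                    bilinear A x y ≡ bilinear A x′ y′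
    bilinear-cong x≗x′ y≗y′ =
      ΣF-cong n λ i → ΣF-cong n λ j → cong₂ (λ a b → A i j *F a *F b) (x≗x′ i) (y≗y′ j)

    bilinear-linearˡ : ∀ s t (x y z : Vec n) →
      bilinear A (λ i → s *F x i +F t *F y i) z ≡ s *F bilinear A x z +F t *F bilinear A y z
    bilinear-linearˡ s t x y z = trans
      (ΣF-cong n λ i → trans
        (ΣF-cong n λ j → solve 6 (λ a s t x y z → a :* (s :* x :+ t :* y) :* z
                                                := s :* (a :* x :* z) :+ t :* (a :* y :* z))
                                 refl (A i j) s t (x i) (y i) (z j))
        (ΣF-linear n s t _ _))
      (ΣF-linear n s t _ _)

    bilinear-linearʳ : ∀ s t (x y z : Vec n) →
      bilinear A x (λ i → s *F y i +F t *F z i) ≡ s *F bilinear A x y +F t *F bilinear A x z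
    bilinear-linearʳ s t x y z = trans
      (ΣF-cong n λ i → trans
        (ΣF-cong n λ j → solve 6 (λ a s t x y z → a :* x :* (s :* y :+ t :* z)
                                                := s :* (a :* x :* y) :+ t :* (a :* x :* z))
                                 refl (A i j) s t (x i) (y j) (z j))
        (ΣF-linear n s t _ _))
      (ΣF-linear n s t _ _)

    Qf-combination : ∀ s t (v w : Vec n) → Qf A (λ i → s *F v i +F t *F w i) ≡
      s *F s *F Qf A v +F s *F t *F (bilinear A v w +F bilinear A w v) +F t *F t *F Qf A w
    Qf-combination s t v w = begin
      bilinear A u u
        ≡⟨ bilinear-linearˡ s t v w u ⟩
      s *F bilinear A v u +F t *F bilinear A w u
        ≡⟨ cong₂ (λ a b → s *F a +F t *F b) (bilinear-linearʳ s t v v w) (bilinear-linearʳ s t w v w) ⟩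
      s *F (s *F Qf A v +F t *F bilinear A v w) +F t *F (s *F bilinear A w v +F t *F Qf A w)
        ≡⟨ solve 6 (λ s t a b c d → s :* (s :* a :+ t :* b) :+ t :* (s :* c :+ t :* d)
                                  := s :* s :* a :+ s :* t :* (b :+ c) :+ t :* t :* d)
                   refl s t (Qf A v) (bilinear A v w) (bilinear A w v) (Qf A w) ⟩
      s *F s *F Qf A v +F s *F t *F (bilinear A v w +F bilinear A w v) +F t *F t *F Qf A w ∎
      where
      open ≡-Reasoning
      u = λ i → s *F v i +F t *F w i

    Bf-polarization : ∀ v w → Bf A v w +F Bf A v w ≡ bilinear A v w +F bilinear A w v
    Bf-polarization v w = begin
      fromℚ ½ *F (Qf A (λ i → v i +F w i) -F Qv -F Qw) +F fromℚ ½ *F (Qf A (λ i → v i +F w i) -F Qv -F Qw)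
        ≡⟨ cong (λ q → fromℚ ½ *F (q -F Qv -F Qw) +F fromℚ ½ *F (q -F Qv -F Qw))
                (trans (bilinear-cong 1v+1w 1v+1w) (Qf-combination 1F 1F v w)) ⟩
      fromℚ ½ *F (Q1 -F Qv -F Qw) +F fromℚ ½ *F (Q1 -F Qv -F Qw)
        ≡⟨ solve 3 (λ a b c → con ½ :* (one a b c :- a :- c) :+ con ½ :* (one a b c :- a :- c) := b)
                   refl Qv (bilinear A v w +F bilinear A w v) Qw ⟩
      bilinear A v w +F bilinear A w v ∎
      where
      open ≡-Reasoning
      Qv = Qf A v
      Qw = Qf A w
      Q1 = 1F *F 1F *F Qv +F 1F *F 1F *F (bilinear A v w +F bilinear A w v) +F 1F *F 1F *F Qw
      one = λ a b c → con 1ℚ :* con 1ℚ :* a :+ con 1ℚ :* con 1ℚ :* b :+ con 1ℚ :* con 1ℚ :* c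
      1v+1w : ∀ i → v i +F w i ≡ 1F *F v i +F 1F *F w i
      1v+1w i = solve 2 (λ x y → x :+ y := con 1ℚ :* x :+ con 1ℚ :* y) refl (v i) (w i)

    private
      0x+0x : ∀ (x : Vec n) → IsZeroVec x → ∀ i → x i ≡ 0F *F x i +F 0F *F x i
      0x+0x x x≡0 i = trans (x≡0 i) (solve 1 (λ y → con 0ℚ := con 0ℚ :* y :+ con 0ℚ :* y) refl (x i))

      0b+0b : ∀ b → 0F *F b +F 0F *F b ≡ 0F
      0b+0b = solve 1 (λ b → con 0ℚ :* b :+ con 0ℚ :* b := con 0ℚ) refl

    bilinear-zeroˡ : ∀ x y → IsZeroVec x → bilinear A x y ≡ 0F
    bilinear-zeroˡ x y x≡0 = begin
      bilinear A x y                                          ≡⟨ bilinear-cong (0x+0x x x≡0) (λ _ → refl) ⟩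
      bilinear A (λ i → 0F *F x i +F 0F *F x i) y             ≡⟨ bilinear-linearˡ 0F 0F x x y ⟩
      0F *F bilinear A x y +F 0F *F bilinear A x y            ≡⟨ 0b+0b (bilinear A x y) ⟩
      0F                                                      ∎
      where open ≡-Reasoning

    bilinear-zeroʳ : ∀ x y → IsZeroVec y → bilinear A x y ≡ 0F
    bilinear-zeroʳ x y y≡0 = begin
      bilinear A x y                                          ≡⟨ bilinear-cong (λ _ → refl) (0x+0x y y≡0) ⟩
      bilinear A x (λ i → 0F *F y i +F 0F *F y i)             ≡⟨ bilinear-linearʳ 0F 0F x y y ⟩
      0F *F bilinear A x y +F 0F *F bilinear A x y            ≡⟨ 0b+0b (bilinear A x y) ⟩
      0F                                                      ∎
      where open ≡-Reasoning

    Bf-zeroʳ : ∀ v w → IsZeroVec w → Bf A v w ≡ 0F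
    Bf-zeroʳ v w w≡0 = begin
      Bf A v w                                        ≡⟨ solve 1 (λ b → b := con ½ :* (b :+ b)) refl (Bf A v w) ⟩
      fromℚ ½ *F (Bf A v w +F Bf A v w)               ≡⟨ cong (fromℚ ½ *F_) (Bf-polarization v w) ⟩
      fromℚ ½ *F (bilinear A v w +F bilinear A w v)
        ≡⟨ cong₂ (λ a b → fromℚ ½ *F (a +F b)) (bilinear-zeroʳ v w w≡0) (bilinear-zeroˡ w v w≡0) ⟩
      fromℚ ½ *F (0F +F 0F)                           ≡⟨ solve 0 (con ½ :* (con 0ℚ :+ con 0ℚ) := con 0ℚ) refl ⟩
      0F                                              ∎
      where open ≡-Reasoning

  -- The ring of integers O_F = ℤ + ℤω

  ιF : ℤ → F
  ιF z = fromℚ (ιℤ z)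

  ιF-+ : ∀ x y → ιF (x ℤ.+ y) ≡ ιF x +F ιF y
  ιF-+ x y = trans (cong fromℚ (ιℤ-+ x y)) (fromℚ-+ (ιℤ x) (ιℤ y))

  ιF-* : ∀ x y → ιF (x ℤ.* y) ≡ ιF x *F ιF y
  ιF-* x y = trans (cong fromℚ (ιℤ-* x y)) (fromℚ-* (ιℤ x) (ιℤ y))

  ιF-neg : ∀ x → ιF (ℤ.- x) ≡ -F ιF x
  ιF-neg x = cong fromℚ (ιℤ-neg x)

  Dℚ≡1+4[D/4] : D ℕ.% 4 ≡ 1 → Dℚ ≡ 1ℚ + ιℤ (+ (D div 4)) * ιℤ (+ 4)
  Dℚ≡1+4[D/4] D%4≡1 = begin
    ιℤ (+ D)
      ≡⟨ cong (λ d → ιℤ (+ d)) (trans (m≡m%n+[m/n]*n D 4) (cong (ℕ._+ (D div 4) ℕ.* 4) D%4≡1)) ⟩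
    ιℤ (+ (1 ℕ.+ (D div 4) ℕ.* 4))
      ≡⟨ cong ιℤ (trans (ℤP.pos-+ 1 ((D div 4) ℕ.* 4)) (cong (λ z → + 1 ℤ.+ z) (ℤP.pos-* (D div 4) 4))) ⟩
    ιℤ (+ 1 ℤ.+ + (D div 4) ℤ.* + 4)
      ≡⟨ trans (ιℤ-+ (+ 1) (+ (D div 4) ℤ.* + 4)) (cong (λ q → 1ℚ + q) (ιℤ-* (+ (D div 4)) (+ 4))) ⟩
    1ℚ + ιℤ (+ (D div 4)) * ιℤ (+ 4)
      ∎
    where open ≡-Reasoning

  ω*ω : Σ ℤ λ e → Σ ℤ λ k → ω *F ω ≡ ιF e *F ω +F ιF k
  ω*ω with D≡1mod4?
  ... | yes D%4≡1 = + 1 , + (D div 4) , F-ext re-eq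
    (solve 0 (con ½ :* con ½ :+ con ½ :* con ½ := con 1ℚ :* con ½ :+ con 0ℚ :* con ½ :+ con 0ℚ) refl)
    where
    open ℚ-Solver.+-*-Solver
    k = ιℤ (+ (D div 4))
    re-eq : ½ * ½ + ½ * ½ * Dℚ ≡ 1ℚ * ½ + 0ℚ * ½ * Dℚ + k
    re-eq rewrite Dℚ≡1+4[D/4] D%4≡1 =
      solve 1 (λ k → con ½ :* con ½ :+ con ½ :* con ½ :* (con 1ℚ :+ k :* con (ιℤ (+ 4)))
                   := con 1ℚ :* con ½ :+ con 0ℚ :* con ½ :* (con 1ℚ :+ k :* con (ιℤ (+ 4))) :+ k) refl k
  ... | no _ = + 0 , + D , F-ext
    (solve 1 (λ d → con 0ℚ :* con 0ℚ :+ con 1ℚ :* con 1ℚ :* d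
                 := con 0ℚ :* con 0ℚ :+ con 0ℚ :* con 1ℚ :* d :+ d) refl Dℚ)
    (solve 0 (con 0ℚ :* con 1ℚ :+ con 1ℚ :* con 0ℚ
              := con 0ℚ :* con 1ℚ :+ con 0ℚ :* con 0ℚ :+ con 0ℚ) refl)
    where open ℚ-Solver.+-*-Solver

  0<ir-ω : 0ℚ < ir ω
  0<ir-ω with D≡1mod4?
  ... | yes _ = ℚP.positive⁻¹ ½
  ... | no _  = ℚP.positive⁻¹ 1ℚ

  ½√Δ≡ir-ω√D : fromℚ ½ *F √Δ ≡ (0ℚ +√D· ir ω)
  ½√Δ≡ir-ω√D with D≡1mod4?
  ... | yes _ = F-ext (solve 1 (λ d → con ½ :* con 0ℚ :+ con 0ℚ :* con 1ℚ :* d := con 0ℚ) refl Dℚ) refl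
    where open ℚ-Solver.+-*-Solver
  ... | no _  = F-ext (solve 1 (λ d → con ½ :* con 0ℚ :+ con 0ℚ :* con (ιℤ (+ 2)) :* d := con 0ℚ) refl Dℚ) refl
    where open ℚ-Solver.+-*-Solver

  Δ/4≡D*ir-ω² : + Δ / 4 ≡ Dℚ * (ir ω * ir ω)
  Δ/4≡D*ir-ω² with D≡1mod4?
  ... | yes _ = ℚP.toℚᵘ-injective $ begin
    ℚ.toℚᵘ (+ D / 4)                                ≈⟨ ℚP.toℚᵘ-fromℚᵘ (ℚᵘ.mkℚᵘ (+ D) 3) ⟩
    ℚᵘ.mkℚᵘ (+ D) 3                                 ≈⟨ ℚᵘ.*≡* (cong (ℤ._* + 4) (ℤP.*-identityʳ (+ D))) ⟨
    ℚᵘ.mkℚᵘ (+ D) 0 ℚᵘ.* ℚ.toℚᵘ (½ * ½)             ≈⟨ ℚᵘP.*-congʳ (ℚP.toℚᵘ-fromℚᵘ (ℚᵘ.mkℚᵘ (+ D) 0)) ⟨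
    ℚ.toℚᵘ Dℚ ℚᵘ.* ℚ.toℚᵘ (½ * ½)                   ≈⟨ ℚP.toℚᵘ-homo-* Dℚ (½ * ½) ⟨
    ℚ.toℚᵘ (Dℚ * (½ * ½))                           ∎
    where open ℚᵘP.≃-Reasoning
  ... | no _ = ℚP.toℚᵘ-injective $ begin
    ℚ.toℚᵘ (+ (4 ℕ.* D) / 4)                        ≈⟨ ℚP.toℚᵘ-fromℚᵘ (ℚᵘ.mkℚᵘ (+ (4 ℕ.* D)) 3) ⟩
    ℚᵘ.mkℚᵘ (+ (4 ℕ.* D)) 3                         ≈⟨ ℚᵘ.*≡* (trans (cong (ℤ._* + 1) (ℤP.pos-* 4 D))
                                                          (solve 1 (λ d → con (+ 4) :* d :* con (+ 1)
                                                                       := d :* con (+ 1) :* con (+ 4)) refl (+ D))) ⟩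
    ℚᵘ.mkℚᵘ (+ D) 0 ℚᵘ.* ℚ.toℚᵘ (1ℚ * 1ℚ)           ≈⟨ ℚᵘP.*-congʳ (ℚP.toℚᵘ-fromℚᵘ (ℚᵘ.mkℚᵘ (+ D) 0)) ⟨
    ℚ.toℚᵘ Dℚ ℚᵘ.* ℚ.toℚᵘ (1ℚ * 1ℚ)                 ≈⟨ ℚP.toℚᵘ-homo-* Dℚ (1ℚ * 1ℚ) ⟨
    ℚ.toℚᵘ (Dℚ * (1ℚ * 1ℚ))                         ∎
    where
    open ℚᵘP.≃-Reasoning
    open ℤ-Solver.+-*-Solver

  InO-+ : ∀ {α β} → InO α → InO β → InO (α +F β)
  InO-+ (m , n , refl) (m′ , n′ , refl) = m ℤ.+ m′ , n ℤ.+ n′ , (begin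
    (ιF m +F ιF n *F ω) +F (ιF m′ +F ιF n′ *F ω)
      ≡⟨ solve 5 (λ a b c d w → (a :+ b :* w) :+ (c :+ d :* w) := (a :+ c) :+ (b :+ d) :* w)
                 refl (ιF m) (ιF n) (ιF m′) (ιF n′) ω ⟩
    (ιF m +F ιF m′) +F (ιF n +F ιF n′) *F ω
      ≡⟨ cong₂ (λ a b → a +F b *F ω) (ιF-+ m m′) (ιF-+ n n′) ⟨
    ιF (m ℤ.+ m′) +F ιF (n ℤ.+ n′) *F ω ∎)
    where
    open ≡-Reasoning
    open F-Solver

  InO-neg : ∀ {α} → InO α → InO (-F α)
  InO-neg (m , n , refl) = ℤ.- m , ℤ.- n , (begin
    -F (ιF m +F ιF n *F ω)              ≡⟨ solve 3 (λ a b w → :- (a :+ b :* w) := :- a :+ :- b :* w) refl (ιF m) (ιF n) ω ⟩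
    -F ιF m +F -F ιF n *F ω             ≡⟨ cong₂ (λ a b → a +F b *F ω) (ιF-neg m) (ιF-neg n) ⟨
    ιF (ℤ.- m) +F ιF (ℤ.- n) *F ω       ∎)
    where
    open ≡-Reasoning
    open F-Solver

  InO-* : ∀ {α β} → InO α → InO β → InO (α *F β)
  InO-* (m , n , refl) (m′ , n′ , refl) with ω*ω
  ... | e , k , ω²≡eω+k = m ℤ.* m′ ℤ.+ n ℤ.* n′ ℤ.* k , m ℤ.* n′ ℤ.+ n ℤ.* m′ ℤ.+ n ℤ.* n′ ℤ.* e , (begin
    (ιF m +F ιF n *F ω) *F (ιF m′ +F ιF n′ *F ω)
      ≡⟨ solve 5 (λ a b c d w → (a :+ b :* w) :* (c :+ d :* w) := a :* c :+ (a :* d :+ b :* c) :* w :+ b :* d :* (w :* w))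
                 refl (ιF m) (ιF n) (ιF m′) (ιF n′) ω ⟩
    ιF m *F ιF m′ +F (ιF m *F ιF n′ +F ιF n *F ιF m′) *F ω +F ιF n *F ιF n′ *F (ω *F ω)
      ≡⟨ cong (λ x → ιF m *F ιF m′ +F (ιF m *F ιF n′ +F ιF n *F ιF m′) *F ω +F ιF n *F ιF n′ *F x) ω²≡eω+k ⟩
    ιF m *F ιF m′ +F (ιF m *F ιF n′ +F ιF n *F ιF m′) *F ω +F ιF n *F ιF n′ *F (ιF e *F ω +F ιF k)
      ≡⟨ solve 7 (λ a b c d w e k → a :* c :+ (a :* d :+ b :* c) :* w :+ b :* d :* (e :* w :+ k)
                                  := (a :* c :+ b :* d :* k) :+ (a :* d :+ b :* c :+ b :* d :* e) :* w)
                 refl (ιF m) (ιF n) (ιF m′) (ιF n′) ω (ιF e) (ιF k) ⟩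
    (ιF m *F ιF m′ +F ιF n *F ιF n′ *F ιF k) +F (ιF m *F ιF n′ +F ιF n *F ιF m′ +F ιF n *F ιF n′ *F ιF e) *F ω
      ≡⟨ cong₂ (λ a b → a +F b *F ω) re-coefficient ir-coefficient ⟨
    ιF (m ℤ.* m′ ℤ.+ n ℤ.* n′ ℤ.* k) +F ιF (m ℤ.* n′ ℤ.+ n ℤ.* m′ ℤ.+ n ℤ.* n′ ℤ.* e) *F ω ∎)
    where
    open ≡-Reasoning
    open F-Solver
    ιF-*³ : ∀ x y z → ιF (x ℤ.* y ℤ.* z) ≡ ιF x *F ιF y *F ιF z
    ιF-*³ x y z = trans (ιF-* (x ℤ.* y) z) (cong (_*F ιF z) (ιF-* x y))
    re-coefficient : ιF (m ℤ.* m′ ℤ.+ n ℤ.* n′ ℤ.* k) ≡ ιF m *F ιF m′ +F ιF n *F ιF n′ *F ιF k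
    re-coefficient = trans (ιF-+ (m ℤ.* m′) (n ℤ.* n′ ℤ.* k)) (cong₂ _+F_ (ιF-* m m′) (ιF-*³ n n′ k))
    ir-coefficient : ιF (m ℤ.* n′ ℤ.+ n ℤ.* m′ ℤ.+ n ℤ.* n′ ℤ.* e) ≡
                     ιF m *F ιF n′ +F ιF n *F ιF m′ +F ιF n *F ιF n′ *F ιF e
    ir-coefficient = trans (ιF-+ (m ℤ.* n′ ℤ.+ n ℤ.* m′) (n ℤ.* n′ ℤ.* e))
      (cong₂ _+F_ (trans (ιF-+ (m ℤ.* n′) (n ℤ.* m′)) (cong₂ _+F_ (ιF-* m n′) (ιF-* n m′))) (ιF-*³ n n′ e))

  InL-combination : ∀ {n m} (g : Fin m → Vec n) {v w s t} → InL g v → InL g w → InO s → InO t →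
                    InL g (λ i → s *F v i +F t *F w i)
  InL-combination {m = m} g {v} {w} {s} {t} (c , c∈O , v≡Σcg) (d , d∈O , w≡Σdg) s∈O t∈O =
    (λ k → s *F c k +F t *F d k) , (λ k → InO-+ (InO-* s∈O (c∈O k)) (InO-* t∈O (d∈O k))) , λ i → begin
      s *F v i +F t *F w i
        ≡⟨ cong₂ (λ a b → s *F a +F t *F b) (v≡Σcg i) (w≡Σdg i) ⟩
      s *F ΣF m (λ k → c k *F g k i) +F t *F ΣF m (λ k → d k *F g k i)
        ≡⟨ ΣF-linear m s t _ _ ⟨
      ΣF m (λ k → s *F (c k *F g k i) +F t *F (d k *F g k i))
        ≡⟨ ΣF-cong m (λ k → solve 5 (λ s t c d x → s :* (c :* x) :+ t :* (d :* x) := (s :* c :+ t :* d) :* x)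
                                    refl s t (c k) (d k) (g k i)) ⟩
      ΣF m (λ k → (s *F c k +F t *F d k) *F g k i) ∎
    where
    open ≡-Reasoning
    open F-Solver

  InO⇒InZ⊎ir-ω≤∣ir∣ : ∀ {α} → InO α → InZ α ⊎ ir ω ≤ ∣ ir α ∣
  InO⇒InZ⊎ir-ω≤∣ir∣ (m , n , refl) with n ℤP.≟ + 0
  ... | yes refl = inj₁ (m , solve 2 (λ x w → x :+ con 0ℚ :* w := x) refl (ιF m) ω)
    where open F-Solver
  ... | no n≢0   = inj₂ $ begin
    ir ω                              ≡⟨ ℚP.*-identityˡ (ir ω) ⟨
    1ℚ * ir ω                         ≤⟨ ℚP.*-monoʳ-≤-nonNeg (ir ω) {{ℚ.nonNegative (ℚP.<⇒≤ 0<ir-ω)}} (1≤∣ιℤ∣ n≢0) ⟩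
    ∣ ιℤ n ∣ * ir ω                   ≡⟨ cong (∣ ιℤ n ∣ *_) (ℚP.0≤p⇒∣p∣≡p (ℚP.<⇒≤ 0<ir-ω)) ⟨
    ∣ ιℤ n ∣ * ∣ ir ω ∣               ≡⟨ ℚP.∣p*q∣≡∣p∣*∣q∣ (ιℤ n) (ir ω) ⟨
    ∣ ιℤ n * ir ω ∣                   ≡⟨ cong ∣_∣ ir-eq ⟨
    ∣ 0ℚ + (ιℤ n * ir ω + 0ℚ * re ω) ∣ ∎
    where
    open ℚP.≤-Reasoning
    ir-eq : 0ℚ + (ιℤ n * ir ω + 0ℚ * re ω) ≡ ιℤ n * ir ω
    ir-eq = solve 3 (λ n y x → con 0ℚ :+ (n :* y :+ con 0ℚ :* x) := n :* y) refl (ιℤ n) (ir ω) (re ω)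
      where open ℚ-Solver.+-*-Solver

  -- Positivity in F

  absF-cases : ∀ x → (Pos x × absF x ≡ x) ⊎ (¬ Pos x × absF x ≡ -F x)
  absF-cases x = by-decision (Pos? x)
    where
    by-decision : (d : Dec (Pos x)) →
      (Pos x × (if isYes d then x else -F x) ≡ x) ⊎ (¬ Pos x × (if isYes d then x else -F x) ≡ -F x)
    by-decision (yes P) = inj₁ (P , refl)
    by-decision (no ¬P) = inj₂ (¬P , refl)

  maxF-elim : ∀ (C : F → Set) u v → (Pos (v -F u) → C v) → (¬ Pos (v -F u) → C u) → C (maxF u v)
  maxF-elim C u v Cv Cu = by-decision (Pos? (v -F u))
    where
    by-decision : (d : Dec (Pos (v -F u))) → C (if isYes d then v else u)
    by-decision (yes P) = Cv P
    by-decision (no ¬P) = Cu ¬P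

  module _ (1<D : 1 ℕ.< D) where

    0<Dℚ : 0ℚ < Dℚ
    0<Dℚ = ℚP.positive⁻¹ Dℚ {{ℚP.normalize-pos D 1 {{_}} {{ℕ.>-nonZero (ℕP.<⇒≤ 1<D)}}}}

    0≤D*x*x : ∀ x → 0ℚ ≤ Dℚ * x * x
    0≤D*x*x x = subst (0ℚ ≤_) (sym (ℚP.*-assoc Dℚ x x)) (*-nonNeg (ℚP.<⇒≤ 0<Dℚ) (0≤x*x x))

    D*-x*-x≡D*x*x : ∀ x → Dℚ * - x * - x ≡ Dℚ * x * x
    D*-x*-x≡D*x*x x = solve 2 (λ d x → d :* :- x :* :- x := d :* x :* x) refl Dℚ x
      where open ℚ-Solver.+-*-Solver

    Pos-re⁺ : ∀ {x} → 0ℚ < x → Pos (x +√D· 0ℚ)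
    Pos-re⁺ {x} 0<x = inj₁ (0<x , subst (_< x * x) (sym (ℚP.*-zeroʳ (Dℚ * 0ℚ))) (*-pos 0<x 0<x))

    Pos-re⁻ : ∀ {x} → Pos (x +√D· 0ℚ) → 0ℚ < x
    Pos-re⁻ (inj₁ (0<x , _))         = 0<x
    Pos-re⁻ (inj₂ (inj₁ (0<0 , _)))  = ⊥-elim (ℚP.<-irrefl refl 0<0)
    Pos-re⁻ (inj₂ (inj₂ (0<x , _)))  = 0<x

    Pos-ir⁺ : ∀ {y} → 0ℚ < y → Pos (0ℚ +√D· y)
    Pos-ir⁺ 0<y = inj₂ (inj₁ (0<y , *-pos (*-pos 0<Dℚ 0<y) 0<y))

    Pos-ir⁻ : ∀ {y} → Pos (0ℚ +√D· y) → 0ℚ < y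
    Pos-ir⁻ (inj₁ (0<0 , _))         = ⊥-elim (ℚP.<-irrefl refl 0<0)
    Pos-ir⁻ (inj₂ (inj₁ (0<y , _)))  = 0<y
    Pos-ir⁻ (inj₂ (inj₂ (0<0 , _)))  = ⊥-elim (ℚP.<-irrefl refl 0<0)

    0≤∧0≤⇒Pos⊎≡0 : ∀ {x y} → 0ℚ ≤ x → 0ℚ ≤ y → Pos (x +√D· y) ⊎ (0ℚ ≡ x × 0ℚ ≡ y)
    0≤∧0≤⇒Pos⊎≡0 {x} {y} 0≤x 0≤y = cases (≤⇒<⊎≡ 0≤x) (≤⇒<⊎≡ 0≤y)
      where
      cases : 0ℚ < x ⊎ 0ℚ ≡ x → 0ℚ < y ⊎ 0ℚ ≡ y → Pos (x +√D· y) ⊎ (0ℚ ≡ x × 0ℚ ≡ y)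
      cases (inj₁ 0<x) (inj₁ 0<y) = inj₁ (inj₂ (inj₂ (0<x , 0<y)))
      cases (inj₁ 0<x) (inj₂ 0≡y) = inj₁ (subst (λ y → Pos (x +√D· y)) 0≡y (Pos-re⁺ 0<x))
      cases (inj₂ 0≡x) (inj₁ 0<y) = inj₁ (subst (λ x → Pos (x +√D· y)) 0≡x (Pos-ir⁺ 0<y))
      cases (inj₂ 0≡x) (inj₂ 0≡y) = inj₂ (0≡x , 0≡y)

    ≤F-coordinatewise : ∀ {p q p′ q′} → p ≤ p′ → q ≤ q′ → (p +√D· q) ≤F (p′ +√D· q′)
    ≤F-coordinatewise p≤p′ q≤q′ =
      Sum.map₂ (λ (0≡x , 0≡y) → F-ext (y-x≡0⇒x≡y (sym 0≡x)) (y-x≡0⇒x≡y (sym 0≡y)))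
               (0≤∧0≤⇒Pos⊎≡0 (x≤y⇒0≤y-x p≤p′) (x≤y⇒0≤y-x q≤q′))

    ¬Pos⇒Pos-neg : ∀ {a b} → a * a ≢ Dℚ * b * b → ¬ Pos (a +√D· b) → Pos (-F (a +√D· b))
    ¬Pos⇒Pos-neg {a} {b} a²≢Db² ¬P = cases (ℚP.<-cmp (Dℚ * b * b) (a * a)) (ℚP.<-cmp 0ℚ a) (ℚP.<-cmp 0ℚ b)
      where
      cases : Tri (Dℚ * b * b < a * a) (Dℚ * b * b ≡ a * a) (a * a < Dℚ * b * b) →
              Tri (0ℚ < a) (0ℚ ≡ a) (a < 0ℚ) → Tri (0ℚ < b) (0ℚ ≡ b) (b < 0ℚ) → Pos (-F (a +√D· b))
      cases (tri≈ _ Db²≡a² _) _ _               = ⊥-elim (a²≢Db² (sym Db²≡a²))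
      cases (tri< Db²<a² _ _) (tri< 0<a _ _) _   = ⊥-elim (¬P (inj₁ (0<a , Db²<a²)))
      cases (tri< Db²<a² _ _) (tri≈ _ 0≡a _) _   =
        ⊥-elim (<⇒≱ (subst (λ a → Dℚ * b * b < a * a) (sym 0≡a) Db²<a²) (0≤D*x*x b))
      cases (tri< Db²<a² _ _) (tri> _ _ a<0) _   =
        inj₁ (ℚP.neg-antimono-< a<0 , subst₂ _<_ (sym (D*-x*-x≡D*x*x b)) (sym (-x*-x≡x*x a)) Db²<a²)
      cases (tri> _ _ a²<Db²) _ (tri< 0<b _ _)   = ⊥-elim (¬P (inj₂ (inj₁ (0<b , a²<Db²))))
      cases (tri> _ _ a²<Db²) _ (tri≈ _ 0≡b _)   =
        ⊥-elim (<⇒≱ (subst (λ b → a * a < Dℚ * b * b) (sym 0≡b) a²<Db²)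
                    (subst (_≤ a * a) (sym (ℚP.*-zeroʳ (Dℚ * 0ℚ))) (0≤x*x a)))
      cases (tri> _ _ a²<Db²) _ (tri> _ _ b<0)   =
        inj₂ (inj₁ (ℚP.neg-antimono-< b<0 , subst₂ _<_ (sym (-x*-x≡x*x a)) (sym (D*-x*-x≡D*x*x b)) a²<Db²))

    TotPos⇒0<re : ∀ {x} → TotPos x → 0ℚ < re x
    TotPos⇒0<re (inj₁ (0<p , _) , _)                             = 0<p
    TotPos⇒0<re (inj₂ (inj₂ (0<p , _)) , _)                      = 0<p
    TotPos⇒0<re (inj₂ (inj₁ _) , inj₁ (0<p , _))                 = 0<p
    TotPos⇒0<re (inj₂ (inj₁ _) , inj₂ (inj₂ (0<p , _)))          = 0<p
    TotPos⇒0<re (inj₂ (inj₁ (0<q , _)) , inj₂ (inj₁ (0<-q , _))) = ⊥-elim (0<x⇒0≮-x 0<q 0<-q)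

    Pos⇒0<ir : ∀ {p q} → Pos (p +√D· q) → Pos (- p +√D· q) → 0ℚ < q
    Pos⇒0<ir (inj₂ (inj₁ (0<q , _))) _                  = 0<q
    Pos⇒0<ir (inj₂ (inj₂ (_ , 0<q))) _                  = 0<q
    Pos⇒0<ir (inj₁ _) (inj₂ (inj₁ (0<q , _)))           = 0<q
    Pos⇒0<ir (inj₁ (0<p , _)) (inj₁ (0<-p , _))         = ⊥-elim (0<x⇒0≮-x 0<p 0<-p)
    Pos⇒0<ir (inj₁ (0<p , _)) (inj₂ (inj₂ (0<-p , _)))  = ⊥-elim (0<x⇒0≮-x 0<p 0<-p)

    Pos[p-q√D]⇒D*q*q<p*p : ∀ {p q} → 0ℚ < q → Pos (p +√D· - q) → Dℚ * q * q < p * p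
    Pos[p-q√D]⇒D*q*q<p*p {q = q} _ (inj₁ (_ , h))    = subst (_< _) (D*-x*-x≡D*x*x q) h
    Pos[p-q√D]⇒D*q*q<p*p 0<q (inj₂ (inj₁ (0<-q , _))) = ⊥-elim (0<x⇒0≮-x 0<q 0<-q)
    Pos[p-q√D]⇒D*q*q<p*p 0<q (inj₂ (inj₂ (_ , 0<-q))) = ⊥-elim (0<x⇒0≮-x 0<q 0<-q)

    TotPos⇒D*q*q<p*p : ∀ {p q} → TotPos (p +√D· q) → Dℚ * q * q < p * p
    TotPos⇒D*q*q<p*p (inj₁ (_ , Dq²<p²) , _)       = Dq²<p²
    TotPos⇒D*q*q<p*p (inj₂ (inj₁ (0<q , _)) , P′)  = Pos[p-q√D]⇒D*q*q<p*p 0<q P′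
    TotPos⇒D*q*q<p*p (inj₂ (inj₂ (_ , 0<q)) , P′)  = Pos[p-q√D]⇒D*q*q<p*p 0<q P′

    0<re[x*conj-y] : ∀ {x y} → TotPos x → TotPos y → 0ℚ < re (x *F conj y)
    0<re[x*conj-y] {a +√D· b} {c +√D· d} x≻0 y≻0 = subst (0ℚ <_) (sym re-eq) (x<y⇒0<y-x Dbd<ac)
      where
      open ℚ-Solver.+-*-Solver
      re-eq : a * c + b * - d * Dℚ ≡ a * c - Dℚ * b * d
      re-eq = solve 5 (λ a b c d r → a :* c :+ b :* :- d :* r := a :* c :- r :* b :* d) refl a b c d Dℚ
      Dbd<ac : Dℚ * b * d < a * c
      Dbd<ac = x*x<y*y⇒x<y (ℚP.<⇒≤ (*-pos (TotPos⇒0<re x≻0) (TotPos⇒0<re y≻0))) $ subst₂ _<_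
        (solve 3 (λ r b d → (r :* b :* b) :* (r :* d :* d) := (r :* b :* d) :* (r :* b :* d)) refl Dℚ b d)
        (solve 2 (λ a c → (a :* a) :* (c :* c) := (a :* c) :* (a :* c)) refl a c)
        (*-mono-<-nonNeg (0≤D*x*x b) (TotPos⇒D*q*q<p*p x≻0) (0≤D*x*x d) (TotPos⇒D*q*q<p*p y≻0))

    -- (y z) y′ = z · N with N = y y′ a positive rational.
    TotPos-factor⇒0≤re : ∀ y z → TotPos y → TotPos (y *F z) ⊎ y *F z ≡ 0F → 0ℚ ≤ re z
    TotPos-factor⇒0≤re y@(p +√D· q) z@(u +√D· v) y≻0 yz⪰0 = ℚP.*-cancelʳ-≤-pos N {{ℚ.positive 0<N}}
      (subst₂ _≤_ (sym (ℚP.*-zeroˡ N)) re[yz·conj-y]≡u*N (0≤re[yz·conj-y] yz⪰0))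
      where
      open ℚ-Solver.+-*-Solver
      N = p * p - Dℚ * q * q
      0<N : 0ℚ < N
      0<N = x<y⇒0<y-x (TotPos⇒D*q*q<p*p y≻0)
      re[yz·conj-y]≡u*N : re ((y *F z) *F conj y) ≡ u * N
      re[yz·conj-y]≡u*N = solve 5 (λ p q u v r → (p :* u :+ q :* v :* r) :* p :+ (p :* v :+ q :* u) :* :- q :* r
                                              := u :* (p :* p :- r :* q :* q))
                                  refl p q u v Dℚ
      0≤re[yz·conj-y] : TotPos (y *F z) ⊎ y *F z ≡ 0F → 0ℚ ≤ re ((y *F z) *F conj y)
      0≤re[yz·conj-y] (inj₁ yz≻0) = ℚP.<⇒≤ (0<re[x*conj-y] yz≻0 y≻0)
      0≤re[yz·conj-y] (inj₂ yz≡0) = ℚP.≤-reflexive (sym (trans (cong (λ x → re (x *F conj y)) yz≡0)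
        (solve 3 (λ p q r → con 0ℚ :* p :+ con 0ℚ :* :- q :* r := con 0ℚ) refl p q Dℚ)))

    maxF-conj : ∀ {p q} → Pos (p +√D· q) → Pos (p +√D· - q) →
                maxF (p +√D· q) (p +√D· - q) ≡ (∣ p ∣ +√D· ∣ q ∣)
    maxF-conj {p} {q} P P′ = maxF-elim (_≡ (∣ p ∣ +√D· ∣ q ∣)) (p +√D· q) (p +√D· - q)
      (λ P-diff → F-ext ∣p∣≡p (sym (0<-x⇒∣x∣≡-x (0<x+x⇒0<x
        (Pos-ir⁻ (subst Pos (F-ext (ℚP.+-inverseʳ p) refl) P-diff))))))
      (λ ¬P-diff → F-ext ∣p∣≡p (sym (0≮-x⇒∣x∣≡x λ 0<-q →
        ¬P-diff (subst Pos (F-ext (sym (ℚP.+-inverseʳ p)) refl) (Pos-ir⁺ (ℚP.+-mono-< 0<-q 0<-q))))))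
      where
      ∣p∣≡p : p ≡ ∣ p ∣
      ∣p∣≡p = sym (ℚP.0≤p⇒∣p∣≡p (ℚP.<⇒≤ (TotPos⇒0<re (P , P′))))

    maxF-negconj : ∀ {p q p′ q′} → p′ ≡ - p → q′ ≡ q → Pos (p +√D· q) → Pos (p′ +√D· q′) →
                   maxF (p +√D· q) (p′ +√D· q′) ≡ (∣ p ∣ +√D· ∣ q ∣)
    maxF-negconj {p} {q} refl refl P P′ = maxF-elim (_≡ (∣ p ∣ +√D· ∣ q ∣)) (p +√D· q) (- p +√D· q)
      (λ P-diff → F-ext (sym (0<-x⇒∣x∣≡-x (0<x+x⇒0<x
        (Pos-re⁻ (subst Pos (F-ext refl (ℚP.+-inverseʳ q)) P-diff))))) ∣q∣≡q)
      (λ ¬P-diff → F-ext (sym (0≮-x⇒∣x∣≡x λ 0<-p →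
        ¬P-diff (subst Pos (F-ext refl (sym (ℚP.+-inverseʳ q))) (Pos-re⁺ (ℚP.+-mono-< 0<-p 0<-p))))) ∣q∣≡q)
      where
      ∣q∣≡q : q ≡ ∣ q ∣
      ∣q∣≡q = sym (ℚP.0≤p⇒∣p∣≡p (ℚP.<⇒≤ (Pos⇒0<ir P P′)))

    SignedAbsF : F → Set
    SignedAbsF x = (Pos x × absF x ≡ x) ⊎ (Pos (-F x) × absF x ≡ -F x)

    signedAbsF : ∀ {a b} → a * a ≢ Dℚ * b * b → SignedAbsF (a +√D· b)
    signedAbsF a²≢Db² = Sum.map₂ (Product.map₁ (¬Pos⇒Pos-neg a²≢Db²)) (absF-cases _)

    maxF-absF-conj : ∀ a b → a * a ≢ Dℚ * b * b →
                     maxF (absF (a +√D· b)) (absF (conj (a +√D· b))) ≡ (∣ a ∣ +√D· ∣ b ∣)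
    maxF-absF-conj a b a²≢Db² = cases (signedAbsF a²≢Db²)
      (signedAbsF (subst (a * a ≢_) (sym (D*-x*-x≡D*x*x b)) a²≢Db²))
      where
      ∣-a∣,∣-b∣ : (∣ - a ∣ +√D· ∣ - b ∣) ≡ (∣ a ∣ +√D· ∣ b ∣)
      ∣-a∣,∣-b∣ = F-ext (ℚP.∣-p∣≡∣p∣ a) (ℚP.∣-p∣≡∣p∣ b)
      cases : SignedAbsF (a +√D· b) → SignedAbsF (a +√D· - b) →
              maxF (absF (a +√D· b)) (absF (a +√D· - b)) ≡ (∣ a ∣ +√D· ∣ b ∣)
      cases (inj₁ (P , e)) (inj₁ (P′ , e′)) = trans (cong₂ maxF e e′) (maxF-conj P P′)
      cases (inj₁ (P , e)) (inj₂ (P′ , e′)) =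
        trans (cong₂ maxF e e′) (maxF-negconj refl (neg-involutive b) P P′)
      cases (inj₂ (P , e)) (inj₁ (P′ , e′)) =
        trans (cong₂ maxF e e′) (trans (maxF-negconj (sym (neg-involutive a)) refl P P′) ∣-a∣,∣-b∣)
      cases (inj₂ (P , e)) (inj₂ (P′ , e′)) = trans (cong₂ maxF e e′) (trans (maxF-conj P P′) ∣-a∣,∣-b∣)

    re-sq<Δ/4⇒InZ : ∀ {β} → InO β → re (β *F β) < + Δ / 4 → InZ β
    re-sq<Δ/4⇒InZ {a +√D· b} β∈O re[β²]<Δ/4 =
      [ id , (λ ir-ω≤∣b∣ → ⊥-elim (ℚP.<-irrefl refl (Δ/4<Δ/4 ir-ω≤∣b∣))) ]′ (InO⇒InZ⊎ir-ω≤∣ir∣ β∈O)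
      where
      Δ/4<Δ/4 : ir ω ≤ ∣ b ∣ → + Δ / 4 < + Δ / 4
      Δ/4<Δ/4 ir-ω≤∣b∣ = begin-strict
        + Δ / 4                     ≡⟨ Δ/4≡D*ir-ω² ⟩
        Dℚ * (ir ω * ir ω)          ≤⟨ ℚP.*-monoˡ-≤-nonNeg Dℚ {{ℚ.nonNegative (ℚP.<⇒≤ 0<Dℚ)}}
                                         (*-mono-≤-nonNeg (ℚP.<⇒≤ 0<ir-ω) ir-ω≤∣b∣ (ℚP.<⇒≤ 0<ir-ω) ir-ω≤∣b∣) ⟩
        Dℚ * (∣ b ∣ * ∣ b ∣)        ≡⟨ cong (Dℚ *_) (trans (sym (ℚP.0≤p⇒∣p∣≡p (0≤x*x b))) (ℚP.∣p*q∣≡∣p∣*∣q∣ b b))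
                                     ⟨
        Dℚ * (b * b)                ≡⟨ ℚP.*-comm Dℚ (b * b) ⟩
        b * b * Dℚ                  ≡⟨ ℚP.+-identityˡ (b * b * Dℚ) ⟨
        0ℚ + b * b * Dℚ             ≤⟨ ℚP.+-monoˡ-≤ (b * b * Dℚ) (0≤x*x a) ⟩
        a * a + b * b * Dℚ          <⟨ re[β²]<Δ/4 ⟩
        + Δ / 4                     ∎
        where open ℚP.≤-Reasoning

    module _ {n m} (A : Fin n → Fin n → F) (g : Fin m → Vec n)
             (quad : IsQuadLattice A g) (cls : IsClassical A g) (tpd : IsTotPosDef A g) where

      re-Bf²≤re-Qf*Qf : ∀ {v w} → InL g v → InL g w → ¬ IsZeroVec w →
                        re (Bf A v w *F Bf A v w) ≤ re (Qf A v *F Qf A w)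
      re-Bf²≤re-Qf*Qf {v} {w} v∈L w∈L w≢0 = 0≤y-x⇒x≤y $
        TotPos-factor⇒0≤re Qw (Qv *F Qw -F B *F B) (tpd w w∈L w≢0)
                           (subst (λ P → TotPos P ⊎ P ≡ 0F) Qx≡ (Qx⪰0 (IsZeroVec? x)))
        where
        B = Bf A v w
        Qv = Qf A v
        Qw = Qf A w
        x : Vec n
        x i = Qw *F v i +F (-F B) *F w i
        Qx≡ : Qf A x ≡ Qw *F (Qv *F Qw -F B *F B)
        Qx≡ = begin
          Qf A x
            ≡⟨ Qf-combination A Qw (-F B) v w ⟩
          Qw *F Qw *F Qv +F Qw *F (-F B) *F (bilinear A v w +F bilinear A w v) +F (-F B) *F (-F B) *F Qw
            ≡⟨ cong (λ S → Qw *F Qw *F Qv +F Qw *F (-F B) *F S +F (-F B) *F (-F B) *F Qw) (Bf-polarization A v w) ⟨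
          Qw *F Qw *F Qv +F Qw *F (-F B) *F (B +F B) +F (-F B) *F (-F B) *F Qw
            ≡⟨ solve 3 (λ s b q → s :* s :* q :+ s :* (:- b) :* (b :+ b) :+ (:- b) :* (:- b) :* s
                                := s :* (q :* s :- b :* b))
                       refl Qw B Qv ⟩
          Qw *F (Qv *F Qw -F B *F B) ∎
          where
          open ≡-Reasoning
          open F-Solver
        Qx⪰0 : Dec (IsZeroVec x) → TotPos (Qf A x) ⊎ Qf A x ≡ 0F
        Qx⪰0 (yes x≡0) = inj₂ (bilinear-zeroʳ A x x x≡0)
        Qx⪰0 (no x≢0)  =
          inj₁ (tpd x (InL-combination g v∈L w∈L (quad w w∈L) (InO-neg (cls v w v∈L w∈L))) x≢0)

    Bf∈ℤ : (n m : ℕ) (A : Fin n → Fin n → F) → (∀ i j → A i j ≡ A j i) → (g : Fin m → Vec n) →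
           IsQuadLattice A g → IsClassical A g → IsTotPosDef A g → (v w : Vec n) → InL g v → InL g w →
           Qf A v *F Qf A w ≺ fromℚ (+ Δ / 4) → InZ (Bf A v w)
    Bf∈ℤ n m A _ g quad cls tpd v w v∈L w∈L QvQw≺Δ/4 = by-cases (IsZeroVec? w)
      where
      by-cases : Dec (IsZeroVec w) → InZ (Bf A v w)
      by-cases (yes w≡0) = + 0 , Bf-zeroʳ A v w w≡0
      by-cases (no w≢0)  = re-sq<Δ/4⇒InZ (cls v w v∈L w∈L) $
        ℚP.≤-<-trans (re-Bf²≤re-Qf*Qf A g quad cls tpd v∈L w∈L w≢0) (0<y-x⇒x<y (TotPos⇒0<re QvQw≺Δ/4))

  module _ (1<D : 1 ℕ.< D) (sqf : Squarefree D) where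

    ½√Δ≤maxF-absF : (α : F) → InO α → ¬ InZ α → fromℚ ½ *F √Δ ≤F maxF (absF α) (absF (conj α))
    ½√Δ≤maxF-absF (a +√D· b) α∈O α∉ℤ = [ (λ α∈ℤ → ⊥-elim (α∉ℤ α∈ℤ)) , bound ]′ (InO⇒InZ⊎ir-ω≤∣ir∣ α∈O)
      where
      bound : ir ω ≤ ∣ b ∣ → fromℚ ½ *F √Δ ≤F maxF (absF (a +√D· b)) (absF (a +√D· - b))
      bound ir-ω≤∣b∣ = subst₂ _≤F_ (sym ½√Δ≡ir-ω√D) (sym (maxF-absF-conj 1<D a b a²≢Db²))
                         (≤F-coordinatewise 1<D (ℚP.0≤∣p∣ a) ir-ω≤∣b∣)
        where
        b≢0 : b ≢ 0ℚ
        b≢0 refl = ℚP.<-irrefl refl (ℚP.<-≤-trans 0<ir-ω ir-ω≤∣b∣)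
        a²≢Db² : a * a ≢ Dℚ * b * b
        a²≢Db² a²≡Db² = b≢0 (ℚ-sq≡D*sq⇒≡0 1<D sqf a b a²≡Db²)

open import Data.Nat using (_<_)

lemma4p1 : (D : ℕ) → 1 < D → Squarefree D →
    let open QF D in
    ((α : F) → InO α → ¬ InZ α →
       fromℚ ½ *F √Δ ≤F maxF (absF α) (absF (conj α)))
    ×
    ((n m : ℕ) (A : Fin n → Fin n → F) → (∀ i j → A i j ≡ A j i) →
     (g : Fin m → Vec n) →
     IsQuadLattice A g → IsClassical A g → IsTotPosDef A g →
     (v w : Vec n) → InL g v → InL g w →
     Qf A v *F Qf A w ≺ fromℚ (+ Δ / 4) →
     InZ (Bf A v w))
lemma4p1 D 1<D sqf = ½√Δ≤maxF-absF D 1<D sqf , Bf∈ℤ D 1<D
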